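{- For all positive integers $r$ and $n$, \[ U_{2r}(n) = (-1)^r\, 2^{n+1} \sum_{1 \le j \le k \le r} \frac{\left(-\frac n2\right)_k \left(\frac12\right)_k \left(\frac n2-r\right)_{r-k}}{(k+j)!\, (k-j)!\, (r-k)!}\,j^{2r}. \]
   Context: For $r\in\mathbb{N}$ and $n\in\mathbb{Z}$ define \[ U_r(n) = \sum_{k\in\mathbb{Z}} \binom{n}{k}\left|\frac{n}{2}-k\right|^r, \] where $0^0=1$, and for $n\ge0$ the binomial coefficient $\binom{n}{k}$ is $0$ if $k<0$ or $k>n$ and $\frac{n!}{(n-k)!\,k!}$ otherwise. $(x)_k = x(x+1)\cdots(x+k-1)$ is the rising factorial, with $(x)_0=1$. -}

module Defs where

open import Data.Nat as ℕ using (ℕ; zero; suc; _!; _∸_)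
open import Data.Nat.Properties using (_!≢0)
open import Data.Nat.Combinatorics using (_C_)
open import Data.Integer as ℤ using (+_)
open import Data.Rational using (ℚ; 0ℚ; 1ℚ; _+_; _*_; _-_; _/_; ∣_∣; -_)

ℕ→ℚ : ℕ → ℚ
ℕ→ℚ m = (+ m) / 1

pow : ℚ → ℕ → ℚ
pow q zero    = 1ℚ
pow q (suc k) = pow q k * q

sumFrom : ℕ → ℕ → (ℕ → ℚ) → ℚ
sumFrom a zero    f = 0ℚ
sumFrom a (suc l) f = f a + sumFrom (suc a) l f

-- Σ_{k = a}^{b} f k   (empty if b < a)
sumRange : ℕ → ℕ → (ℕ → ℚ) → ℚ
sumRange a b f = sumFrom a (suc b ∸ a) f

rising : ℚ → ℕ → ℚ
rising x zero    = 1ℚ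
rising x (suc k) = rising x k * (x + ℕ→ℚ k)

invFact : ℕ → ℚ
invFact m = ((+ 1) / (m !)) {{m !≢0}}

-- U_r(n) = Σ_{k ∈ ℤ} C(n,k) |n/2 - k|^r  for n ≥ 0;
-- the binomial coefficient vanishes outside 0 ≤ k ≤ n, so the sum runs over k = 0..n.
U : ℕ → ℕ → ℚ
U r n = sumRange 0 n (λ k → ℕ→ℚ (n C k) * pow ∣ (+ n) / 2 - ℕ→ℚ k ∣ r)

RHS : ℕ → ℕ → ℚ
RHS r n =
  pow (- 1ℚ) r * pow (ℕ→ℚ 2) (suc n) *
  sumRange 1 r (λ k → sumRange 1 k (λ j →
    rising (- ((+ n) / 2)) k * rising ((+ 1) / 2) k * rising ((+ n) / 2 - ℕ→ℚ r) (r ∸ k)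
    * (invFact (k ℕ.+ j) * invFact (k ∸ j) * invFact (r ∸ k))
    * pow (ℕ→ℚ j) (2 ℕ.* r)))

-- Write U_{2r}(n) = Σₖ C(n,k) ((n/2 - k)²)^r.  Absorption gives
-- C(N,k) (N/2 - k)² = (N/2)² C(N,k) - N (N - 1) C(N - 2, k - 1), a recurrence in (r, n) showing that
-- U_{2r}(n) = 2ⁿ M_r(n) for a polynomial M_r of degree at most r.  Lagrange interpolation of M_r at the
-- nodes n = 0, 2, ..., 2r produces the factors (-n/2)_k (n/2 - r)_{r-k} / (k! (r-k)!), and at n = 2k the
-- symmetric sum Σᵢ C(2k,i) (k - i)^{2r} = 2 (2k)! Σⱼ j^{2r} / ((k+j)! (k-j)!) together with
-- (2k)! = 4ᵏ k! (½)ₖ supplies the rest.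

module Submission where

open import Defs
open import Data.Nat as ℕ using (ℕ; zero; suc; _!; _∸_)
import Data.Nat.Properties as ℕP
open import Data.Nat.Combinatorics using (_C_; nCk≡nC[n∸k]; nC1≡n; nCk+nC[k+1]≡[n+1]C[k+1]; k![n∸k]!∣n!)
open import Data.Nat.Combinatorics.Specification using (nCk≡n!/k![n-k]!; k>n⇒nCk≡0)
open import Data.Nat.DivMod using (m/n*n≡m)
open import Data.Integer as ℤ using () renaming (+_ to ⁺_)
import Data.Integer.Properties as ℤP
open import Data.Rational
open import Data.Rational.Properties
import Data.Rational.Unnormalised as U
import Data.Rational.Unnormalised.Properties as UP
open import Data.Product using (Σ; _×_; _,_)
open import Data.Sum using (inj₁; inj₂)
open import Relation.Binary using (tri<; tri≈; tri>)
open import Relation.Binary.PropositionalEquality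
open import Relation.Nullary using (contradiction)
open import Data.Rational.Solver
open +-*-Solver
import Data.Integer.Solver as ℤSolver
module ℤS = ℤSolver.+-*-Solver
import Data.Nat.Solver as ℕSolver
module ℕS = ℕSolver.+-*-Solver

ι : ℕ → ℚ
ι = ℕ→ℚ

fromℚᵘ-homo-+ : ∀ p q → fromℚᵘ (p U.+ q) ≡ fromℚᵘ p + fromℚᵘ q
fromℚᵘ-homo-+ p q = toℚᵘ-injective (begin
    toℚᵘ (fromℚᵘ (p U.+ q))             ≈⟨ toℚᵘ-fromℚᵘ (p U.+ q) ⟩
    p U.+ q                             ≈⟨ UP.+-cong (UP.≃-sym (toℚᵘ-fromℚᵘ p)) (UP.≃-sym (toℚᵘ-fromℚᵘ q)) ⟩
    toℚᵘ (fromℚᵘ p) U.+ toℚᵘ (fromℚᵘ q) ≈⟨ UP.≃-sym (toℚᵘ-homo-+ (fromℚᵘ p) (fromℚᵘ q)) ⟩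
    toℚᵘ (fromℚᵘ p + fromℚᵘ q)          ∎)
  where open UP.≃-Reasoning

fromℚᵘ-homo-* : ∀ p q → fromℚᵘ (p U.* q) ≡ fromℚᵘ p * fromℚᵘ q
fromℚᵘ-homo-* p q = toℚᵘ-injective (begin
    toℚᵘ (fromℚᵘ (p U.* q))             ≈⟨ toℚᵘ-fromℚᵘ (p U.* q) ⟩
    p U.* q                             ≈⟨ UP.*-cong (UP.≃-sym (toℚᵘ-fromℚᵘ p)) (UP.≃-sym (toℚᵘ-fromℚᵘ q)) ⟩
    toℚᵘ (fromℚᵘ p) U.* toℚᵘ (fromℚᵘ q) ≈⟨ UP.≃-sym (toℚᵘ-homo-* (fromℚᵘ p) (fromℚᵘ q)) ⟩
    toℚᵘ (fromℚᵘ p * fromℚᵘ q)          ∎)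
  where open UP.≃-Reasoning

ι-+ : ∀ a b → ι (a ℕ.+ b) ≡ ι a + ι b
ι-+ a b = trans (fromℚᵘ-cong {U.mkℚᵘ (⁺ (a ℕ.+ b)) 0} {U.mkℚᵘ (⁺ a) 0 U.+ U.mkℚᵘ (⁺ b) 0} (U.*≡* (trans (cong (ℤ._* ⁺ 1) (ℤP.pos-+ a b)) (ℤS.solve 2
            (λ x y → (x ℤS.:+ y) ℤS.:* ℤS.con (⁺ 1)
                     ℤS.:= (x ℤS.:* ℤS.con (⁺ 1) ℤS.:+ y ℤS.:* ℤS.con (⁺ 1)) ℤS.:* ℤS.con (⁺ 1)) refl (⁺ a) (⁺ b)))))
          (fromℚᵘ-homo-+ (U.mkℚᵘ (⁺ a) 0) (U.mkℚᵘ (⁺ b) 0))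

ι-* : ∀ a b → ι (a ℕ.* b) ≡ ι a * ι b
ι-* a b = trans (fromℚᵘ-cong {U.mkℚᵘ (⁺ (a ℕ.* b)) 0} {U.mkℚᵘ (⁺ a) 0 U.* U.mkℚᵘ (⁺ b) 0} (U.*≡* (cong (ℤ._* ⁺ 1) (ℤP.pos-* a b))))
                (fromℚᵘ-homo-* (U.mkℚᵘ (⁺ a) 0) (U.mkℚᵘ (⁺ b) 0))

ι-suc : ∀ m → ι (suc m) ≡ 1ℚ + ι m
ι-suc = ι-+ 1

ι-∸ : ∀ a b → b ℕ.≤ a → ι (a ∸ b) ≡ ι a - ι b
ι-∸ a b b≤a = begin
    ι (a ∸ b)                ≡⟨ solve 2 (λ x y → x := (x :+ y) :- y) refl (ι (a ∸ b)) (ι b) ⟩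
    (ι (a ∸ b) + ι b) - ι b  ≡⟨ cong (_- ι b) (sym (ι-+ (a ∸ b) b)) ⟩
    ι (a ∸ b ℕ.+ b) - ι b    ≡⟨ cong (λ z → ι z - ι b) (ℕP.m∸n+n≡m b≤a) ⟩
    ι a - ι b                ∎
  where open ≡-Reasoning

ι-injective : ∀ a b → ι a ≡ ι b → a ≡ b
ι-injective a b eq with UP.≃-trans (UP.≃-sym (toℚᵘ-fromℚᵘ (U.mkℚᵘ (⁺ a) 0)))
                          (UP.≃-trans (toℚᵘ-cong eq) (toℚᵘ-fromℚᵘ (U.mkℚᵘ (⁺ b) 0)))
... | U.*≡* e = ℤP.+-injective (trans (sym (ℤP.*-identityʳ (⁺ a))) (trans e (ℤP.*-identityʳ (⁺ b))))

n/2≡ι[n]*½ : ∀ n → (⁺ n) / 2 ≡ ι n * ½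
n/2≡ι[n]*½ n = trans (fromℚᵘ-cong {U.mkℚᵘ (⁺ n) 1} {U.mkℚᵘ (⁺ n) 0 U.* U.mkℚᵘ (⁺ 1) 1} (U.*≡* (ℤS.solve 1
                  (λ x → x ℤS.:* ℤS.con (⁺ 2) ℤS.:= (x ℤS.:* ℤS.con (⁺ 1)) ℤS.:* ℤS.con (⁺ 2)) refl (⁺ n))))
               (fromℚᵘ-homo-* (U.mkℚᵘ (⁺ n) 0) (U.mkℚᵘ (⁺ 1) 1))

ι[2*n]*½≡ι[n] : ∀ n → ι (2 ℕ.* n) * ½ ≡ ι n
ι[2*n]*½≡ι[n] n = trans (cong (_* ½) (ι-* 2 n)) (solve 1 (λ x → con (ι 2) :* x :* con ½ := x) refl (ι n))

m/n*ι[n]≡ι[m] : ∀ m n .{{_ : ℕ.NonZero n}} → ((⁺ m) / n) * ι n ≡ ι m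
m/n*ι[n]≡ι[m] m (suc d) = trans (sym (fromℚᵘ-homo-* (U.mkℚᵘ (⁺ m) d) (U.mkℚᵘ (⁺ suc d) 0)))
  (fromℚᵘ-cong {U.mkℚᵘ (⁺ m) d U.* U.mkℚᵘ (⁺ suc d) 0} {U.mkℚᵘ (⁺ m) 0}
    (U.*≡* (trans (ℤS.solve 2 (λ x y → (x ℤS.:* y) ℤS.:* ℤS.con (⁺ 1) ℤS.:= x ℤS.:* y) refl (⁺ m) (⁺ suc d))
                  (cong (λ z → ⁺ m ℤ.* ⁺ z) (sym (ℕP.*-identityʳ (suc d)))))))

invFact-inverseˡ : ∀ m → invFact m * ι (m !) ≡ 1ℚ
invFact-inverseˡ m = m/n*ι[n]≡ι[m] 1 (m !) {{m ℕP.!≢0}}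

pow-+ : ∀ q a b → pow q (a ℕ.+ b) ≡ pow q a * pow q b
pow-+ q a zero    = trans (cong (pow q) (ℕP.+-identityʳ a)) (sym (*-identityʳ (pow q a)))
pow-+ q a (suc b) = begin
    pow q (a ℕ.+ suc b)    ≡⟨ cong (pow q) (ℕP.+-suc a b) ⟩
    pow q (a ℕ.+ b) * q    ≡⟨ cong (_* q) (pow-+ q a b) ⟩
    pow q a * pow q b * q  ≡⟨ *-assoc (pow q a) (pow q b) q ⟩
    pow q a * (pow q b * q) ∎
  where open ≡-Reasoning

pow-* : ∀ p q n → pow (p * q) n ≡ pow p n * pow q n
pow-* p q zero    = refl
pow-* p q (suc n) = begin
    pow (p * q) n * (p * q)      ≡⟨ cong (_* (p * q)) (pow-* p q n) ⟩
    pow p n * pow q n * (p * q)  ≡⟨ solve 4 (λ a b x y → a :* b :* (x :* y) := a :* x :* (b :* y)) refl (pow p n) (pow q n) p q ⟩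
    pow p n * p * (pow q n * q)  ∎
  where open ≡-Reasoning

pow-2* : ∀ q r → pow q (2 ℕ.* r) ≡ pow (q * q) r
pow-2* q r = begin
    pow q (2 ℕ.* r)    ≡⟨ cong (λ s → pow q (r ℕ.+ s)) (ℕP.+-identityʳ r) ⟩
    pow q (r ℕ.+ r)    ≡⟨ pow-+ q r r ⟩
    pow q r * pow q r  ≡⟨ sym (pow-* q q r) ⟩
    pow (q * q) r      ∎
  where open ≡-Reasoning

pow-1ℚ : ∀ r → pow 1ℚ r ≡ 1ℚ
pow-1ℚ zero    = refl
pow-1ℚ (suc r) = trans (*-identityʳ _) (pow-1ℚ r)

pow-inverse : ∀ p q r → p * q ≡ 1ℚ → pow p r * pow q r ≡ 1ℚ
pow-inverse p q r pq≡1 = trans (sym (pow-* p q r)) (trans (cong (λ s → pow s r) pq≡1) (pow-1ℚ r))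

∣p∣*∣p∣≡p*p : ∀ p → ∣ p ∣ * ∣ p ∣ ≡ p * p
∣p∣*∣p∣≡p*p p with ≤-total 0ℚ p
... | inj₁ 0≤p rewrite 0≤p⇒∣p∣≡p 0≤p = refl
... | inj₂ p≤0 = begin
    ∣ p ∣ * ∣ p ∣      ≡⟨ cong (λ z → z * z) (sym (∣-p∣≡∣p∣ p)) ⟩
    ∣ - p ∣ * ∣ - p ∣  ≡⟨ cong (λ z → z * z) (0≤p⇒∣p∣≡p (neg-antimono-≤ p≤0)) ⟩
    (- p) * (- p)      ≡⟨ solve 1 (λ x → (:- x) :* (:- x) := x :* x) refl p ⟩
    p * p              ∎
  where open ≡-Reasoning

p≢0∧p*q≡0⇒q≡0 : ∀ p q → p ≢ 0ℚ → p * q ≡ 0ℚ → q ≡ 0ℚ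
p≢0∧p*q≡0⇒q≡0 p q p≢0 pq≡0 = begin
    q              ≡⟨ sym (*-identityˡ q) ⟩
    1ℚ * q         ≡⟨ cong (_* q) (sym (*-inverseˡ p)) ⟩
    p⁻¹ * p * q    ≡⟨ *-assoc p⁻¹ p q ⟩
    p⁻¹ * (p * q)  ≡⟨ cong (p⁻¹ *_) pq≡0 ⟩
    p⁻¹ * 0ℚ       ≡⟨ *-zeroʳ p⁻¹ ⟩
    0ℚ             ∎
  where
    open ≡-Reasoning
    instance _ = ≢-nonZero p≢0
    p⁻¹ = 1/ p

p≢q⇒p-q≢0 : ∀ p q → p ≢ q → p - q ≢ 0ℚ
p≢q⇒p-q≢0 p q p≢q p-q≡0 = p≢q (begin
    p            ≡⟨ solve 2 (λ x y → x := (x :- y) :+ y) refl p q ⟩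
    (p - q) + q  ≡⟨ cong (_+ q) p-q≡0 ⟩
    0ℚ + q       ≡⟨ +-identityˡ q ⟩
    q            ∎)
  where open ≡-Reasoning

sumFrom-cong : ∀ a l {f g : ℕ → ℚ} → (∀ i → a ℕ.≤ i → i ℕ.< a ℕ.+ l → f i ≡ g i) →
               sumFrom a l f ≡ sumFrom a l g
sumFrom-cong a zero    f≗g = refl
sumFrom-cong a (suc l) f≗g = cong₂ _+_ (f≗g a ℕP.≤-refl (ℕP.m<m+n a ℕ.z<s))
  (sumFrom-cong (suc a) l (λ i a<i i<a+1+l → f≗g i (ℕP.<⇒≤ a<i) (subst (i ℕ.<_) (sym (ℕP.+-suc a l)) i<a+1+l)))

sumFrom-shift : ∀ c a l (f : ℕ → ℚ) → sumFrom (c ℕ.+ a) l f ≡ sumFrom a l (λ i → f (c ℕ.+ i))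
sumFrom-shift zero    a l f = refl
sumFrom-shift (suc c) a l f = trans (shift₁ (c ℕ.+ a) l f) (sumFrom-shift c a l (λ i → f (suc i)))
  where
    shift₁ : ∀ a l (f : ℕ → ℚ) → sumFrom (suc a) l f ≡ sumFrom a l (λ i → f (suc i))
    shift₁ a zero    f = refl
    shift₁ a (suc l) f = cong (f (suc a) +_) (shift₁ (suc a) l f)

sumFrom-split : ∀ a l₁ l₂ (f : ℕ → ℚ) → sumFrom a (l₁ ℕ.+ l₂) f ≡ sumFrom a l₁ f + sumFrom (a ℕ.+ l₁) l₂ f
sumFrom-split a zero     l₂ f = trans (cong (λ b → sumFrom b l₂ f) (sym (ℕP.+-identityʳ a))) (sym (+-identityˡ _))
sumFrom-split a (suc l₁) l₂ f = begin
    f a + sumFrom (suc a) (l₁ ℕ.+ l₂) f                          ≡⟨ cong (f a +_) (sumFrom-split (suc a) l₁ l₂ f) ⟩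
    f a + (sumFrom (suc a) l₁ f + sumFrom (suc a ℕ.+ l₁) l₂ f)  ≡⟨ sym (+-assoc (f a) _ _) ⟩
    f a + sumFrom (suc a) l₁ f + sumFrom (suc a ℕ.+ l₁) l₂ f    ≡⟨ cong (λ b → f a + sumFrom (suc a) l₁ f + sumFrom b l₂ f) (sym (ℕP.+-suc a l₁)) ⟩
    f a + sumFrom (suc a) l₁ f + sumFrom (a ℕ.+ suc l₁) l₂ f    ∎
  where open ≡-Reasoning

sumFrom-snoc : ∀ a l (f : ℕ → ℚ) → sumFrom a (suc l) f ≡ sumFrom a l f + f (a ℕ.+ l)
sumFrom-snoc a l f = begin
    sumFrom a (suc l) f                        ≡⟨ cong (λ m → sumFrom a m f) (ℕP.+-comm 1 l) ⟩
    sumFrom a (l ℕ.+ 1) f                      ≡⟨ sumFrom-split a l 1 f ⟩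
    sumFrom a l f + (f (a ℕ.+ l) + 0ℚ)         ≡⟨ cong (sumFrom a l f +_) (+-identityʳ _) ⟩
    sumFrom a l f + f (a ℕ.+ l)                ∎
  where open ≡-Reasoning

sumFrom-+ : ∀ a l (f g : ℕ → ℚ) → sumFrom a l (λ i → f i + g i) ≡ sumFrom a l f + sumFrom a l g
sumFrom-+ a zero    f g = refl
sumFrom-+ a (suc l) f g = trans (cong (f a + g a +_) (sumFrom-+ (suc a) l f g))
  (solve 4 (λ x y z w → x :+ y :+ (z :+ w) := x :+ z :+ (y :+ w)) refl (f a) (g a) (sumFrom (suc a) l f) (sumFrom (suc a) l g))

sumFrom-*ˡ : ∀ a l c (f : ℕ → ℚ) → sumFrom a l (λ i → c * f i) ≡ c * sumFrom a l f
sumFrom-*ˡ a zero    c f = sym (*-zeroʳ c)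
sumFrom-*ˡ a (suc l) c f = trans (cong (c * f a +_) (sumFrom-*ˡ (suc a) l c f)) (sym (*-distribˡ-+ c (f a) _))

sumFrom-zero : ∀ a l (f : ℕ → ℚ) → (∀ i → a ℕ.≤ i → i ℕ.< a ℕ.+ l → f i ≡ 0ℚ) → sumFrom a l f ≡ 0ℚ
sumFrom-zero a l f f≗0 = trans (sumFrom-cong a l f≗0) (sum0 a l)
  where
    sum0 : ∀ a l → sumFrom a l (λ _ → 0ℚ) ≡ 0ℚ
    sum0 a zero    = refl
    sum0 a (suc l) = trans (+-identityˡ _) (sum0 (suc a) l)

sumFrom-reverse : ∀ l (f : ℕ → ℚ) → sumFrom 0 l f ≡ sumFrom 0 l (λ i → f (l ∸ suc i))
sumFrom-reverse zero    f = refl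
sumFrom-reverse (suc l) f = begin
    f 0 + sumFrom 1 l f                               ≡⟨ cong (f 0 +_) (sumFrom-shift 1 0 l f) ⟩
    f 0 + sumFrom 0 l (λ i → f (suc i))               ≡⟨ cong (f 0 +_) (sumFrom-reverse l (λ i → f (suc i))) ⟩
    f 0 + sumFrom 0 l (λ i → f (suc (l ∸ suc i)))     ≡⟨ cong (f 0 +_) (sumFrom-cong 0 l (λ i _ i<l → cong f (sym (ℕP.+-∸-assoc 1 i<l)))) ⟩
    f 0 + sumFrom 0 l g                               ≡⟨ +-comm (f 0) _ ⟩
    sumFrom 0 l g + f 0                               ≡⟨ cong (λ i → sumFrom 0 l g + f i) (sym (ℕP.n∸n≡0 l)) ⟩
    sumFrom 0 l g + g l                               ≡⟨ sym (sumFrom-snoc 0 l g) ⟩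
    sumFrom 0 (suc l) g                               ∎
  where
    open ≡-Reasoning
    g : ℕ → ℚ
    g i = f (suc l ∸ suc i)

sumFrom-delta : ∀ m r (f : ℕ → ℚ) → m ℕ.≤ r → (∀ i → i ℕ.≤ r → i ≢ m → f i ≡ 0ℚ) → sumFrom 0 (suc r) f ≡ f m
sumFrom-delta m r f m≤r f≗0 = begin
    sumFrom 0 (suc r) f                                     ≡⟨ cong (λ l → sumFrom 0 l f) (sym m+[1+r∸m]≡1+r) ⟩
    sumFrom 0 (m ℕ.+ suc (r ∸ m)) f                         ≡⟨ sumFrom-split 0 m (suc (r ∸ m)) f ⟩
    sumFrom 0 m f + (f m + sumFrom (suc m) (r ∸ m) f)       ≡⟨ cong₂ (λ x y → x + (f m + y)) below above ⟩
    0ℚ + (f m + 0ℚ)                                         ≡⟨ trans (+-identityˡ _) (+-identityʳ _) ⟩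
    f m                                                     ∎
  where
    open ≡-Reasoning
    m+[1+r∸m]≡1+r : m ℕ.+ suc (r ∸ m) ≡ suc r
    m+[1+r∸m]≡1+r = trans (ℕP.+-suc m (r ∸ m)) (cong suc (ℕP.m+[n∸m]≡n m≤r))
    below : sumFrom 0 m f ≡ 0ℚ
    below = sumFrom-zero 0 m f (λ i _ i<m → f≗0 i (ℕP.≤-trans (ℕP.<⇒≤ i<m) m≤r) (ℕP.<⇒≢ i<m))
    above : sumFrom (suc m) (r ∸ m) f ≡ 0ℚ
    above = sumFrom-zero (suc m) (r ∸ m) f (λ i m<i i<end →
      f≗0 i (ℕ.s≤s⁻¹ (subst (i ℕ.<_) (cong suc (ℕP.m+[n∸m]≡n m≤r)) i<end)) (ℕP.>⇒≢ m<i))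

-- Polynomial functions of degree at most m, described without coefficients: the constants for m = 0,
-- and for m + 1 the functions all of whose divided differences (f t - f a) / (t - a) have degree at most m.
Poly≤ : ℕ → (ℚ → ℚ) → Set
Poly≤ zero    f = ∀ t → f t ≡ f 0ℚ
Poly≤ (suc m) f = ∀ a → Σ (ℚ → ℚ) λ g → Poly≤ m g × (∀ t → f t ≡ f a + (t - a) * g t)

Poly≤-cong : ∀ m {f g : ℚ → ℚ} → (∀ t → f t ≡ g t) → Poly≤ m f → Poly≤ m g
Poly≤-cong zero    f≗g pf t = trans (sym (f≗g t)) (trans (pf t) (f≗g 0ℚ))
Poly≤-cong (suc m) f≗g pf a with pf a
... | h , ph , f≡ = h , ph , λ t → trans (sym (f≗g t)) (trans (f≡ t) (cong (λ z → z + (t - a) * h t) (f≗g a)))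

Poly≤-const : ∀ m c → Poly≤ m (λ _ → c)
Poly≤-const zero    c t = refl
Poly≤-const (suc m) c a = (λ _ → 0ℚ) , Poly≤-const m 0ℚ , λ t → solve 3 (λ c t a → c := c :+ (t :- a) :* con 0ℚ) refl c t a

Poly≤-+ : ∀ m {f g} → Poly≤ m f → Poly≤ m g → Poly≤ m (λ t → f t + g t)
Poly≤-+ zero            pf pg t = cong₂ _+_ (pf t) (pg t)
Poly≤-+ (suc m) {f} {g} pf pg a with pf a | pg a
... | f′ , pf′ , f≡ | g′ , pg′ , g≡ = (λ t → f′ t + g′ t) , Poly≤-+ m pf′ pg′ , λ t →
  trans (cong₂ _+_ (f≡ t) (g≡ t))
        (solve 6 (λ fa ga t a x y → fa :+ (t :- a) :* x :+ (ga :+ (t :- a) :* y) := fa :+ ga :+ (t :- a) :* (x :+ y))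
               refl (f a) (g a) t a (f′ t) (g′ t))

Poly≤-scale : ∀ m c {f} → Poly≤ m f → Poly≤ m (λ t → c * f t)
Poly≤-scale zero    c     pf t = cong (c *_) (pf t)
Poly≤-scale (suc m) c {f} pf a with pf a
... | g , pg , f≡ = (λ t → c * g t) , Poly≤-scale m c pg , λ t →
  trans (cong (c *_) (f≡ t)) (solve 5 (λ c fa t a x → c :* (fa :+ (t :- a) :* x) := c :* fa :+ (t :- a) :* (c :* x)) refl c (f a) t a (g t))

Poly≤-translate : ∀ m c {f} → Poly≤ m f → Poly≤ m (λ t → f (t + c))
Poly≤-translate zero    c     pf t = trans (pf (t + c)) (sym (pf (0ℚ + c)))
Poly≤-translate (suc m) c {f} pf a with pf (a + c)
... | g , pg , f≡ = (λ t → g (t + c)) , Poly≤-translate m c pg , λ t →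
  trans (f≡ (t + c)) (cong (λ z → f (a + c) + z * g (t + c)) (solve 3 (λ t c a → (t :+ c) :- (a :+ c) := t :- a) refl t c a))

Poly≤-dilate : ∀ m c {f} → Poly≤ m f → Poly≤ m (λ t → f (c * t))
Poly≤-dilate zero    c     pf t = trans (pf (c * t)) (sym (pf (c * 0ℚ)))
Poly≤-dilate (suc m) c {f} pf a with pf (c * a)
... | g , pg , f≡ = (λ t → c * g (c * t)) , Poly≤-scale m c (Poly≤-dilate m c pg) , λ t →
  trans (f≡ (c * t)) (cong (f (c * a) +_) (solve 4 (λ c t a x → (c :* t :- c :* a) :* x := (t :- a) :* (c :* x)) refl c t a (g (c * t))))

Poly≤-*-affine : ∀ m α β {f} → Poly≤ m f → Poly≤ (suc m) (λ t → f t * (α * t + β))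
Poly≤-*-affine zero    α β {f} pf a = (λ _ → f 0ℚ * α) , Poly≤-const 0 _ , λ t →
  trans (cong (_* (α * t + β)) (pf t))
    (trans (solve 5 (λ k α β t a → k :* (α :* t :+ β) := k :* (α :* a :+ β) :+ (t :- a) :* (k :* α)) refl (f 0ℚ) α β t a)
           (cong (λ z → z * (α * a + β) + (t - a) * (f 0ℚ * α)) (sym (pf a))))
Poly≤-*-affine (suc m) α β {f} pf a with pf a
... | g , pg , f≡ = (λ t → g t * (α * t + β) + f a * α) , Poly≤-+ (suc m) (Poly≤-*-affine m α β pg) (Poly≤-const (suc m) _) , λ t →
  trans (cong (_* (α * t + β)) (f≡ t))
        (solve 6 (λ fa x α β t a → (fa :+ (t :- a) :* x) :* (α :* t :+ β) := fa :* (α :* a :+ β) :+ (t :- a) :* (x :* (α :* t :+ β) :+ fa :* α))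
               refl (f a) (g t) α β t a)

Poly≤-difference : ∀ m c {f} → Poly≤ (suc m) f → Poly≤ m (λ t → f t - f (t + c))
Poly≤-difference zero c {f} pf with pf 0ℚ
... | g , pg , f≡ = λ t → trans (Δf≡ t) (sym (Δf≡ 0ℚ))
  where
    Δf≡ : ∀ s → f s - f (s + c) ≡ - (c * g 0ℚ)
    Δf≡ s = begin
      f s - f (s + c)                                                 ≡⟨ cong₂ _-_ (f≡ s) (f≡ (s + c)) ⟩
      (f 0ℚ + (s - 0ℚ) * g s) - (f 0ℚ + ((s + c) - 0ℚ) * g (s + c))  ≡⟨ cong₂ (λ x y → (f 0ℚ + (s - 0ℚ) * x) - (f 0ℚ + ((s + c) - 0ℚ) * y)) (pg s) (pg (s + c)) ⟩
      (f 0ℚ + (s - 0ℚ) * g 0ℚ) - (f 0ℚ + ((s + c) - 0ℚ) * g 0ℚ)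
        ≡⟨ solve 4 (λ f0 s c g0 → (f0 :+ (s :- con 0ℚ) :* g0) :- (f0 :+ ((s :+ c) :- con 0ℚ) :* g0) := :- (c :* g0)) refl (f 0ℚ) s c (g 0ℚ) ⟩
      - (c * g 0ℚ)                                                    ∎
      where open ≡-Reasoning
Poly≤-difference (suc m) c {f} pf a with pf a
... | g , pg , f≡ with pg (a + c)
...   | h , ph , g≡ = (λ t → (g t - g (t + c)) + (- c) * h (t + c)) ,
        Poly≤-+ m (Poly≤-difference m c pg) (Poly≤-scale m (- c) (Poly≤-translate m c ph)) , λ t → begin
      f t - f (t + c)
        ≡⟨ cong₂ _-_ (f≡ t) (f≡ (t + c)) ⟩
      (f a + (t - a) * g t) - (f a + ((t + c) - a) * g (t + c))
        ≡⟨ cong (λ z → (f a + (t - a) * g t) - (f a + ((t + c) - a) * z)) (g≡ (t + c)) ⟩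
      (f a + (t - a) * g t) - (f a + ((t + c) - a) * (g (a + c) + ((t + c) - (a + c)) * h (t + c)))
        ≡⟨ solve 7 (λ fa gt gac ht t a c →
              (fa :+ (t :- a) :* gt) :- (fa :+ ((t :+ c) :- a) :* (gac :+ ((t :+ c) :- (a :+ c)) :* ht))
              := (fa :- (fa :+ ((a :+ c) :- a) :* gac)) :+ (t :- a) :* ((gt :- (gac :+ ((t :+ c) :- (a :+ c)) :* ht)) :+ (:- c) :* ht))
            refl (f a) (g t) (g (a + c)) (h (t + c)) t a c ⟩
      (f a - (f a + ((a + c) - a) * g (a + c))) + (t - a) * ((g t - (g (a + c) + ((t + c) - (a + c)) * h (t + c))) + (- c) * h (t + c))
        ≡⟨ cong₂ (λ x y → (f a - x) + (t - a) * ((g t - y) + (- c) * h (t + c))) (sym (f≡ (a + c))) (sym (g≡ (t + c))) ⟩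
      (f a - f (a + c)) + (t - a) * ((g t - g (t + c)) + (- c) * h (t + c)) ∎
  where open ≡-Reasoning

Poly≤-vanishing : ∀ m {f} (p : ℕ → ℚ) → (∀ i j → p i ≡ p j → i ≡ j) →
                  (∀ i → i ℕ.≤ m → f (p i) ≡ 0ℚ) → Poly≤ m f → ∀ t → f t ≡ 0ℚ
Poly≤-vanishing zero    {f} p p-inj f[p]≡0 pf t = trans (pf t) (trans (sym (pf (p 0))) (f[p]≡0 0 ℕ.z≤n))
Poly≤-vanishing (suc m) {f} p p-inj f[p]≡0 pf t with pf (p 0)
... | g , pg , f≡ = begin
    f t                          ≡⟨ f≡ t ⟩
    f (p 0) + (t - p 0) * g t    ≡⟨ cong₂ (λ x y → x + (t - p 0) * y) (f[p]≡0 0 ℕ.z≤n) g≡0 ⟩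
    0ℚ + (t - p 0) * 0ℚ          ≡⟨ solve 2 (λ t q → con 0ℚ :+ (t :- q) :* con 0ℚ := con 0ℚ) refl t (p 0) ⟩
    0ℚ                           ∎
  where
    open ≡-Reasoning
    g[p∘suc]≡0 : ∀ i → i ℕ.≤ m → g (p (suc i)) ≡ 0ℚ
    g[p∘suc]≡0 i i≤m = p≢0∧p*q≡0⇒q≡0 (p (suc i) - p 0) _ (p≢q⇒p-q≢0 _ _ (λ eq → ℕP.1+n≢0 (p-inj (suc i) 0 eq)))
      (begin
        (p (suc i) - p 0) * g (p (suc i))          ≡⟨ sym (+-identityˡ _) ⟩
        0ℚ + (p (suc i) - p 0) * g (p (suc i))     ≡⟨ cong (_+ _) (sym (f[p]≡0 0 ℕ.z≤n)) ⟩
        f (p 0) + (p (suc i) - p 0) * g (p (suc i)) ≡⟨ sym (f≡ (p (suc i))) ⟩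
        f (p (suc i))                              ≡⟨ f[p]≡0 (suc i) (ℕ.s≤s i≤m) ⟩
        0ℚ                                         ∎)
    g≡0 : g t ≡ 0ℚ
    g≡0 = Poly≤-vanishing m (λ i → p (suc i)) (λ i j eq → ℕP.suc-injective (p-inj (suc i) (suc j) eq)) g[p∘suc]≡0 pg t

Poly≤-sumFrom : ∀ m a l (G : ℕ → ℚ → ℚ) → (∀ k → a ℕ.≤ k → k ℕ.< a ℕ.+ l → Poly≤ m (G k)) →
                Poly≤ m (λ t → sumFrom a l (λ k → G k t))
Poly≤-sumFrom m a zero    G pG = Poly≤-const m 0ℚ
Poly≤-sumFrom m a (suc l) G pG = Poly≤-+ m (pG a ℕP.≤-refl (ℕP.m<m+n a ℕ.z<s))
  (Poly≤-sumFrom m (suc a) l G (λ k a<k k<end → pG k (ℕP.<⇒≤ a<k) (subst (k ℕ.<_) (sym (ℕP.+-suc a l)) k<end)))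

Poly≤-*-rising : ∀ m j α β {f} → Poly≤ m f → Poly≤ (m ℕ.+ j) (λ t → f t * rising (α * t + β) j)
Poly≤-*-rising m zero α β {f} pf =
  subst (λ d → Poly≤ d (λ t → f t * 1ℚ)) (sym (ℕP.+-identityʳ m)) (Poly≤-cong m (λ t → sym (*-identityʳ (f t))) pf)
Poly≤-*-rising m (suc j) α β {f} pf = subst (λ d → Poly≤ d (λ t → f t * rising (α * t + β) (suc j))) (sym (ℕP.+-suc m j))
  (Poly≤-cong (suc (m ℕ.+ j))
    (λ t → trans (*-assoc (f t) _ _) (cong (λ z → f t * (rising (α * t + β) j * z)) (sym (+-assoc (α * t) β (ι j)))))
    (Poly≤-*-affine (m ℕ.+ j) α (β + ι j) (Poly≤-*-rising m j α β pf)))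

-- Lagrange interpolation

rising-zero : ∀ x k m → m ℕ.< k → x + ι m ≡ 0ℚ → rising x k ≡ 0ℚ
rising-zero x (suc k) m m<1+k x+m≡0 with ℕP.m<1+n⇒m<n∨m≡n m<1+k
... | inj₁ m<k  = trans (cong (_* (x + ι k)) (rising-zero x k m m<k x+m≡0)) (*-zeroˡ (x + ι k))
... | inj₂ refl = trans (cong (rising x k *_) x+m≡0) (*-zeroʳ (rising x k))

rising-suc-first : ∀ x k → rising x (suc k) ≡ x * rising (x + 1ℚ) k
rising-suc-first x zero    = solve 1 (λ x → con 1ℚ :* (x :+ con 0ℚ) := x :* con 1ℚ) refl x
rising-suc-first x (suc k) = begin
    rising x (suc k) * (x + ι (suc k))         ≡⟨ cong₂ (λ a b → a * (x + b)) (rising-suc-first x k) (ι-suc k) ⟩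
    x * rising (x + 1ℚ) k * (x + (1ℚ + ι k))   ≡⟨ solve 3 (λ x r k → x :* r :* (x :+ (con 1ℚ :+ k)) := x :* (r :* ((x :+ con 1ℚ) :+ k))) refl x (rising (x + 1ℚ) k) (ι k) ⟩
    x * (rising (x + 1ℚ) k * ((x + 1ℚ) + ι k)) ∎
  where open ≡-Reasoning

rising-neg : ∀ s → rising (- ι s) s ≡ pow (- 1ℚ) s * ι (s !)
rising-neg zero    = refl
rising-neg (suc s) = begin
    rising (- ι (suc s)) (suc s)                      ≡⟨ rising-suc-first (- ι (suc s)) s ⟩
    - ι (suc s) * rising (- ι (suc s) + 1ℚ) s         ≡⟨ cong (λ z → - ι (suc s) * rising z s) -[1+s]+1≡-s ⟩
    - ι (suc s) * rising (- ι s) s                    ≡⟨ cong (- ι (suc s) *_) (rising-neg s) ⟩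
    - ι (suc s) * (pow (- 1ℚ) s * ι (s !))            ≡⟨ solve 3 (λ a p f → (:- a) :* (p :* f) := p :* (:- con 1ℚ) :* (a :* f)) refl (ι (suc s)) (pow (- 1ℚ) s) (ι (s !)) ⟩
    pow (- 1ℚ) (suc s) * (ι (suc s) * ι (s !))        ≡⟨ cong (pow (- 1ℚ) (suc s) *_) (sym (ι-* (suc s) (s !))) ⟩
    pow (- 1ℚ) (suc s) * ι (suc s !)                  ∎
  where
    open ≡-Reasoning
    -[1+s]+1≡-s : - ι (suc s) + 1ℚ ≡ - ι s
    -[1+s]+1≡-s = trans (cong (λ z → - z + 1ℚ) (ι-suc s)) (solve 1 (λ S → (:- (con 1ℚ :+ S)) :+ con 1ℚ := :- S) refl (ι s))

-- (-1)^r lagrangeBasis r k is the Lagrange basis polynomial of the nodes 0, 1, ..., r that takes the value 1 at k.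
lagrangeBasis : ℕ → ℕ → ℚ → ℚ
lagrangeBasis r k x = rising (- x) k * rising (x - ι r) (r ∸ k) * (invFact k * invFact (r ∸ k))

lagrangeBasis-off : ∀ r i k → i ℕ.≤ r → k ≢ i → lagrangeBasis r k (ι i) ≡ 0ℚ
lagrangeBasis-off r i k i≤r k≢i with ℕP.<-cmp k i
... | tri≈ _ k≡i _ = contradiction k≡i k≢i
... | tri< k<i _ _ = trans (cong (λ z → rising (- ι i) k * z * c) (rising-zero (ι i - ι r) (r ∸ k) (r ∸ i) (ℕP.∸-monoʳ-< k<i i≤r) i-r+[r∸i]≡0))
                           (solve 2 (λ a c → a :* con 0ℚ :* c := con 0ℚ) refl (rising (- ι i) k) c)
  where
    c = invFact k * invFact (r ∸ k)
    i-r+[r∸i]≡0 : ι i - ι r + ι (r ∸ i) ≡ 0ℚ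
    i-r+[r∸i]≡0 = trans (cong (ι i - ι r +_) (ι-∸ r i i≤r)) (solve 2 (λ a b → a :- b :+ (b :- a) := con 0ℚ) refl (ι i) (ι r))
... | tri> _ _ i<k = trans (cong (λ z → z * rising (ι i - ι r) (r ∸ k) * c) (rising-zero (- ι i) k i i<k (+-inverseˡ (ι i))))
                           (solve 2 (λ a c → con 0ℚ :* a :* c := con 0ℚ) refl (rising (ι i - ι r) (r ∸ k)) c)
  where c = invFact k * invFact (r ∸ k)

lagrangeBasis-on : ∀ r i → i ℕ.≤ r → lagrangeBasis r i (ι i) ≡ pow (- 1ℚ) r
lagrangeBasis-on r i i≤r = begin
    rising (- ι i) i * rising (ι i - ι r) (r ∸ i) * (invFact i * invFact (r ∸ i))
      ≡⟨ cong₂ (λ a b → a * b * (invFact i * invFact (r ∸ i))) (rising-neg i) (trans (cong (λ z → rising z (r ∸ i)) i-r≡-[r∸i]) (rising-neg (r ∸ i))) ⟩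
    (s₁ * ι (i !)) * (s₂ * ι ((r ∸ i) !)) * (invFact i * invFact (r ∸ i))
      ≡⟨ solve 6 (λ s₁ s₂ a b fa fb → (s₁ :* a) :* (s₂ :* b) :* (fa :* fb) := s₁ :* s₂ :* (fa :* a) :* (fb :* b))
                 refl s₁ s₂ (ι (i !)) (ι ((r ∸ i) !)) (invFact i) (invFact (r ∸ i)) ⟩
    s₁ * s₂ * (invFact i * ι (i !)) * (invFact (r ∸ i) * ι ((r ∸ i) !))
      ≡⟨ cong₂ (λ a b → s₁ * s₂ * a * b) (invFact-inverseˡ i) (invFact-inverseˡ (r ∸ i)) ⟩
    s₁ * s₂ * 1ℚ * 1ℚ    ≡⟨ trans (*-identityʳ _) (*-identityʳ _) ⟩
    s₁ * s₂              ≡⟨ sym (pow-+ (- 1ℚ) i (r ∸ i)) ⟩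
    pow (- 1ℚ) (i ℕ.+ (r ∸ i)) ≡⟨ cong (pow (- 1ℚ)) (ℕP.m+[n∸m]≡n i≤r) ⟩
    pow (- 1ℚ) r         ∎
  where
    open ≡-Reasoning
    s₁ = pow (- 1ℚ) i
    s₂ = pow (- 1ℚ) (r ∸ i)
    i-r≡-[r∸i] : ι i - ι r ≡ - ι (r ∸ i)
    i-r≡-[r∸i] = trans (solve 2 (λ a b → a :- b := :- (b :- a)) refl (ι i) (ι r)) (cong -_ (sym (ι-∸ r i i≤r)))

Poly≤-lagrangeBasis : ∀ r k → k ℕ.≤ r → Poly≤ r (lagrangeBasis r k)
Poly≤-lagrangeBasis r k k≤r = Poly≤-cong r basis≡ (Poly≤-scale r c (subst (λ d → Poly≤ d product) (ℕP.m+[n∸m]≡n k≤r) product-poly))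
  where
    c = invFact k * invFact (r ∸ k)
    product : ℚ → ℚ
    product x = 1ℚ * rising ((- 1ℚ) * x + 0ℚ) k * rising (1ℚ * x + (- ι r)) (r ∸ k)
    product-poly : Poly≤ (k ℕ.+ (r ∸ k)) product
    product-poly = Poly≤-*-rising k (r ∸ k) 1ℚ (- ι r) (Poly≤-*-rising 0 k (- 1ℚ) 0ℚ (Poly≤-const 0 1ℚ))
    basis≡ : ∀ x → c * product x ≡ lagrangeBasis r k x
    basis≡ x = trans (cong₂ (λ a b → c * (1ℚ * rising a k * rising b (r ∸ k)))
                       (solve 1 (λ x → (:- con 1ℚ) :* x :+ con 0ℚ := :- x) refl x)
                       (solve 2 (λ x r → con 1ℚ :* x :+ (:- r) := x :- r) refl x (ι r)))
                     (solve 3 (λ c a b → c :* (con 1ℚ :* a :* b) := a :* b :* c) refl c (rising (- x) k) (rising (x - ι r) (r ∸ k)))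

lagrange-interpolation : ∀ r {f} → Poly≤ r f → ∀ x →
                         f x ≡ pow (- 1ℚ) r * sumFrom 0 (suc r) (λ k → lagrangeBasis r k x * f (ι k))
lagrange-interpolation r {f} pf x = begin
    f x                          ≡⟨ solve 2 (λ a b → a := (a :+ (:- con 1ℚ) :* b) :+ b) refl (f x) (L x) ⟩
    (f x + (- 1ℚ) * L x) + L x   ≡⟨ cong (_+ L x) (Poly≤-vanishing r ι ι-injective f-L[i]≡0 pf-L x) ⟩
    0ℚ + L x                     ≡⟨ +-identityˡ (L x) ⟩
    L x                          ∎
  where
    open ≡-Reasoning
    L : ℚ → ℚ
    L y = pow (- 1ℚ) r * sumFrom 0 (suc r) (λ k → lagrangeBasis r k y * f (ι k))
    pf-L : Poly≤ r (λ y → f y + (- 1ℚ) * L y)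
    pf-L = Poly≤-+ r pf (Poly≤-scale r (- 1ℚ) (Poly≤-scale r (pow (- 1ℚ) r) (Poly≤-sumFrom r 0 (suc r) _ (λ k _ k<1+r →
             Poly≤-cong r (λ y → *-comm (f (ι k)) _) (Poly≤-scale r (f (ι k)) (Poly≤-lagrangeBasis r k (ℕ.s≤s⁻¹ k<1+r)))))))
    L[i]≡f[i] : ∀ i → i ℕ.≤ r → L (ι i) ≡ f (ι i)
    L[i]≡f[i] i i≤r = begin
      pow (- 1ℚ) r * sumFrom 0 (suc r) (λ k → lagrangeBasis r k (ι i) * f (ι k))
        ≡⟨ cong (pow (- 1ℚ) r *_) (sumFrom-delta i r (λ k → lagrangeBasis r k (ι i) * f (ι k)) i≤r (λ k _ k≢i →
             trans (cong (_* f (ι k)) (lagrangeBasis-off r i k i≤r k≢i)) (*-zeroˡ (f (ι k))))) ⟩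
      pow (- 1ℚ) r * (lagrangeBasis r i (ι i) * f (ι i))     ≡⟨ cong (λ z → pow (- 1ℚ) r * (z * f (ι i))) (lagrangeBasis-on r i i≤r) ⟩
      pow (- 1ℚ) r * (pow (- 1ℚ) r * f (ι i))                ≡⟨ sym (*-assoc (pow (- 1ℚ) r) (pow (- 1ℚ) r) (f (ι i))) ⟩
      pow (- 1ℚ) r * pow (- 1ℚ) r * f (ι i)                  ≡⟨ cong (_* f (ι i)) (pow-inverse (- 1ℚ) (- 1ℚ) r refl) ⟩
      1ℚ * f (ι i)                                           ≡⟨ *-identityˡ _ ⟩
      f (ι i)                                                ∎
    f-L[i]≡0 : ∀ i → i ℕ.≤ r → f (ι i) + (- 1ℚ) * L (ι i) ≡ 0ℚ
    f-L[i]≡0 i i≤r = trans (cong (λ z → f (ι i) + (- 1ℚ) * z) (L[i]≡f[i] i i≤r))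
                           (solve 1 (λ a → a :+ (:- con 1ℚ) :* a := con 0ℚ) refl (f (ι i)))

[1+k]*[1+n]C[1+k]≡[1+n]*nCk : ∀ n k → suc k ℕ.* (suc n C suc k) ≡ suc n ℕ.* (n C k)
[1+k]*[1+n]C[1+k]≡[1+n]*nCk zero    zero    = refl
[1+k]*[1+n]C[1+k]≡[1+n]*nCk zero    (suc k) = ℕP.*-zeroʳ (suc (suc k))
[1+k]*[1+n]C[1+k]≡[1+n]*nCk (suc n) zero    = trans (ℕP.*-identityˡ _) (trans (nC1≡n (suc (suc n))) (sym (ℕP.*-identityʳ (suc (suc n)))))
[1+k]*[1+n]C[1+k]≡[1+n]*nCk (suc n) (suc k) = begin
    suc (suc k) ℕ.* (suc (suc n) C suc (suc k))        ≡⟨ cong (suc (suc k) ℕ.*_) (sym (nCk+nC[k+1]≡[n+1]C[k+1] (suc n) (suc k))) ⟩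
    suc (suc k) ℕ.* (a ℕ.+ b)
      ≡⟨ ℕS.solve 3 (λ k a b → (ℕS.con 2 ℕS.:+ k) ℕS.:* (a ℕS.:+ b) ℕS.:= a ℕS.:+ (ℕS.con 1 ℕS.:+ k) ℕS.:* a ℕS.:+ (ℕS.con 2 ℕS.:+ k) ℕS.:* b) refl k a b ⟩
    a ℕ.+ suc k ℕ.* a ℕ.+ suc (suc k) ℕ.* b            ≡⟨ cong₂ (λ x y → a ℕ.+ x ℕ.+ y) ([1+k]*[1+n]C[1+k]≡[1+n]*nCk n k) ([1+k]*[1+n]C[1+k]≡[1+n]*nCk n (suc k)) ⟩
    a ℕ.+ suc n ℕ.* (n C k) ℕ.+ suc n ℕ.* (n C suc k)  ≡⟨ trans (ℕP.+-assoc a _ _) (cong (a ℕ.+_) (sym (ℕP.*-distribˡ-+ (suc n) (n C k) (n C suc k)))) ⟩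
    a ℕ.+ suc n ℕ.* (n C k ℕ.+ n C suc k)              ≡⟨ cong (λ z → a ℕ.+ suc n ℕ.* z) (nCk+nC[k+1]≡[n+1]C[k+1] n k) ⟩
    suc (suc n) ℕ.* a                                  ∎
  where
    open ≡-Reasoning
    a = suc n C suc k
    b = suc n C suc (suc k)

[1+n]Ck*[1+n∸k]≡[1+n]*nCk : ∀ n k → k ℕ.≤ suc n → (suc n C k) ℕ.* (suc n ∸ k) ≡ suc n ℕ.* (n C k)
[1+n]Ck*[1+n∸k]≡[1+n]*nCk n k k≤1+n with ℕP.m≤n⇒m<n∨m≡n k≤1+n
... | inj₂ refl = begin
    (suc n C suc n) ℕ.* (n ∸ n)  ≡⟨ cong ((suc n C suc n) ℕ.*_) (ℕP.n∸n≡0 n) ⟩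
    (suc n C suc n) ℕ.* 0        ≡⟨ ℕP.*-zeroʳ (suc n C suc n) ⟩
    0                            ≡⟨ sym (ℕP.*-zeroʳ (suc n)) ⟩
    suc n ℕ.* 0                  ≡⟨ cong (suc n ℕ.*_) (sym (k>n⇒nCk≡0 {n} {suc n} ℕP.≤-refl)) ⟩
    suc n ℕ.* (n C suc n)        ∎
  where open ≡-Reasoning
... | inj₁ (ℕ.s≤s k≤n) = begin
    (suc n C k) ℕ.* (suc n ∸ k)                 ≡⟨ cong₂ ℕ._*_ (nCk≡nC[n∸k] k≤1+n) 1+n∸k≡1+[n∸k] ⟩
    (suc n C (suc n ∸ k)) ℕ.* suc (n ∸ k)       ≡⟨ cong (λ z → (suc n C z) ℕ.* suc (n ∸ k)) 1+n∸k≡1+[n∸k] ⟩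
    (suc n C suc (n ∸ k)) ℕ.* suc (n ∸ k)       ≡⟨ ℕP.*-comm _ (suc (n ∸ k)) ⟩
    suc (n ∸ k) ℕ.* (suc n C suc (n ∸ k))       ≡⟨ [1+k]*[1+n]C[1+k]≡[1+n]*nCk n (n ∸ k) ⟩
    suc n ℕ.* (n C (n ∸ k))                     ≡⟨ cong (suc n ℕ.*_) (sym (nCk≡nC[n∸k] k≤n)) ⟩
    suc n ℕ.* (n C k)                           ∎
  where
    open ≡-Reasoning
    1+n∸k≡1+[n∸k] : suc n ∸ k ≡ suc (n ∸ k)
    1+n∸k≡1+[n∸k] = ℕP.+-∸-assoc 1 k≤n

[2+n]C[1+k]*[1+k]*[1+n∸k]≡[2+n]*[1+n]*nCk : ∀ n k → k ℕ.≤ suc n →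
  (suc (suc n) C suc k) ℕ.* suc k ℕ.* (suc n ∸ k) ≡ suc (suc n) ℕ.* suc n ℕ.* (n C k)
[2+n]C[1+k]*[1+k]*[1+n∸k]≡[2+n]*[1+n]*nCk n k k≤1+n = begin
    (suc (suc n) C suc k) ℕ.* suc k ℕ.* (suc n ∸ k)   ≡⟨ cong (ℕ._* (suc n ∸ k)) (trans (ℕP.*-comm (suc (suc n) C suc k) (suc k)) ([1+k]*[1+n]C[1+k]≡[1+n]*nCk (suc n) k)) ⟩
    suc (suc n) ℕ.* (suc n C k) ℕ.* (suc n ∸ k)       ≡⟨ ℕP.*-assoc (suc (suc n)) (suc n C k) (suc n ∸ k) ⟩
    suc (suc n) ℕ.* ((suc n C k) ℕ.* (suc n ∸ k))     ≡⟨ cong (suc (suc n) ℕ.*_) ([1+n]Ck*[1+n∸k]≡[1+n]*nCk n k k≤1+n) ⟩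
    suc (suc n) ℕ.* (suc n ℕ.* (n C k))               ≡⟨ sym (ℕP.*-assoc (suc (suc n)) (suc n) (n C k)) ⟩
    suc (suc n) ℕ.* suc n ℕ.* (n C k)                 ∎
  where open ≡-Reasoning

nCk*[k!*[n∸k]!]≡n! : ∀ n k → k ℕ.≤ n → (n C k) ℕ.* (k ! ℕ.* (n ∸ k) !) ≡ n !
nCk*[k!*[n∸k]!]≡n! n k k≤n = trans (cong (ℕ._* (k ! ℕ.* (n ∸ k) !)) (nCk≡n!/k![n-k]! k≤n)) (m/n*n≡m {{_}} (k![n∸k]!∣n! k≤n))

ι[nCk]≡n!/[k!*[n∸k]!] : ∀ n k → k ℕ.≤ n → ι (n C k) ≡ ι (n !) * (invFact k * invFact (n ∸ k))
ι[nCk]≡n!/[k!*[n∸k]!] n k k≤n = begin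
    c                            ≡⟨ sym (trans (cong₂ (λ x y → c * x * y) (invFact-inverseˡ k) (invFact-inverseˡ (n ∸ k))) (trans (*-identityʳ _) (*-identityʳ c))) ⟩
    c * (a⁻¹ * a) * (b⁻¹ * b)    ≡⟨ solve 5 (λ c a b a⁻¹ b⁻¹ → c :* (a⁻¹ :* a) :* (b⁻¹ :* b) := c :* (a :* b) :* (a⁻¹ :* b⁻¹)) refl c a b a⁻¹ b⁻¹ ⟩
    c * (a * b) * (a⁻¹ * b⁻¹)    ≡⟨ cong (_* (a⁻¹ * b⁻¹)) c*a*b≡n! ⟩
    ι (n !) * (a⁻¹ * b⁻¹)        ∎
  where
    open ≡-Reasoning
    c = ι (n C k)
    a = ι (k !)
    b = ι ((n ∸ k) !)
    a⁻¹ = invFact k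
    b⁻¹ = invFact (n ∸ k)
    c*a*b≡n! : c * (a * b) ≡ ι (n !)
    c*a*b≡n! = trans (cong (c *_) (sym (ι-* (k !) ((n ∸ k) !))))
                     (trans (sym (ι-* (n C k) (k ! ℕ.* (n ∸ k) !))) (cong ι (nCk*[k!*[n∸k]!]≡n! n k k≤n)))

[2k]C[k∸j]≡[2k]C[k+j] : ∀ k j → j ℕ.≤ k → (2 ℕ.* k) C (k ∸ j) ≡ (2 ℕ.* k) C (k ℕ.+ j)
[2k]C[k∸j]≡[2k]C[k+j] k j j≤k = begin
    (2 ℕ.* k) C (k ∸ j)                  ≡⟨ nCk≡nC[n∸k] (ℕP.≤-trans (ℕP.m∸n≤m k j) (ℕP.m≤m+n k (k ℕ.+ 0))) ⟩
    (2 ℕ.* k) C (k ℕ.+ (k ℕ.+ 0) ∸ (k ∸ j)) ≡⟨ cong (λ z → (2 ℕ.* k) C (k ℕ.+ z ∸ (k ∸ j))) (ℕP.+-identityʳ k) ⟩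
    (2 ℕ.* k) C (k ℕ.+ k ∸ (k ∸ j))      ≡⟨ cong ((2 ℕ.* k) C_) (ℕP.+-∸-assoc k (ℕP.m∸n≤m k j)) ⟩
    (2 ℕ.* k) C (k ℕ.+ (k ∸ (k ∸ j)))    ≡⟨ cong (λ z → (2 ℕ.* k) C (k ℕ.+ z)) (ℕP.m∸[m∸n]≡n j≤k) ⟩
    (2 ℕ.* k) C (k ℕ.+ j)                ∎
  where open ≡-Reasoning

ι[[2k]C[k+j]]≡[2k]!/[[k+j]!*[k∸j]!] : ∀ k j → j ℕ.≤ k →
  ι ((2 ℕ.* k) C (k ℕ.+ j)) ≡ ι ((2 ℕ.* k) !) * (invFact (k ℕ.+ j) * invFact (k ∸ j))
ι[[2k]C[k+j]]≡[2k]!/[[k+j]!*[k∸j]!] k j j≤k =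
  trans (ι[nCk]≡n!/[k!*[n∸k]!] (2 ℕ.* k) (k ℕ.+ j) (ℕP.+-monoʳ-≤ k (ℕP.≤-trans j≤k (ℕP.m≤m+n k 0))))
        (cong (λ z → ι ((2 ℕ.* k) !) * (invFact (k ℕ.+ j) * invFact z)) 2k∸[k+j]≡k∸j)
  where
    2k∸[k+j]≡k∸j : 2 ℕ.* k ∸ (k ℕ.+ j) ≡ k ∸ j
    2k∸[k+j]≡k∸j = trans (ℕP.[m+n]∸[m+o]≡n∸o k (k ℕ.+ 0) j) (cong (_∸ j) (ℕP.+-identityʳ k))

sumFrom-binomial : ∀ n → sumFrom 0 (suc n) (λ k → ι (n C k)) ≡ pow (ι 2) n
sumFrom-binomial zero    = refl
sumFrom-binomial (suc n) = begin
    ι (suc n C 0) + sumFrom 1 (suc n) (λ k → ι (suc n C k))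
      ≡⟨ cong (1ℚ +_) (sumFrom-shift 1 0 (suc n) (λ k → ι (suc n C k))) ⟩
    1ℚ + sumFrom 0 (suc n) (λ k → ι (suc n C suc k))
      ≡⟨ cong (1ℚ +_) (sumFrom-cong 0 (suc n) (λ k _ _ → trans (cong ι (sym (nCk+nC[k+1]≡[n+1]C[k+1] n k))) (ι-+ (n C k) (n C suc k)))) ⟩
    1ℚ + sumFrom 0 (suc n) (λ k → ι (n C k) + ι (n C suc k))
      ≡⟨ cong (1ℚ +_) (sumFrom-+ 0 (suc n) (λ k → ι (n C k)) (λ k → ι (n C suc k))) ⟩
    1ℚ + (S + sumFrom 0 (suc n) (λ k → ι (n C suc k)))
      ≡⟨ cong (λ z → 1ℚ + (S + z)) (sym (sumFrom-shift 1 0 (suc n) (λ k → ι (n C k)))) ⟩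
    1ℚ + (S + sumFrom 1 (suc n) (λ k → ι (n C k)))
      ≡⟨ solve 3 (λ a s t → a :+ (s :+ t) := s :+ (a :+ t)) refl 1ℚ S (sumFrom 1 (suc n) (λ k → ι (n C k))) ⟩
    S + sumFrom 0 (suc (suc n)) (λ k → ι (n C k))
      ≡⟨ cong (S +_) (sumFrom-snoc 0 (suc n) (λ k → ι (n C k))) ⟩
    S + (S + ι (n C suc n))
      ≡⟨ cong (λ z → S + (S + ι z)) (k>n⇒nCk≡0 {n} {suc n} ℕP.≤-refl) ⟩
    S + (S + 0ℚ)
      ≡⟨ cong (λ z → z + (z + 0ℚ)) (sumFrom-binomial n) ⟩
    pow (ι 2) n + (pow (ι 2) n + 0ℚ)
      ≡⟨ solve 1 (λ x → x :+ (x :+ con 0ℚ) := x :* con (ι 2)) refl (pow (ι 2) n) ⟩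
    pow (ι 2) n * ι 2 ∎
  where
    open ≡-Reasoning
    S = sumFrom 0 (suc n) (λ k → ι (n C k))

-- The even moments and their recurrence

dev : ℕ → ℕ → ℚ
dev n k = (⁺ n) / 2 - ι k

evenU : ℕ → ℕ → ℚ
evenU r n = sumFrom 0 (suc n) (λ k → ι (n C k) * pow (dev n k * dev n k) r)

U-even : ∀ r n → U (2 ℕ.* r) n ≡ evenU r n
U-even r n = sumFrom-cong 0 (suc n) (λ k _ _ → cong (ι (n C k) *_)
  (trans (pow-2* ∣ dev n k ∣ r) (cong (λ z → pow z r) (∣p∣*∣p∣≡p*p (dev n k)))))

dev-2* : ∀ k i → dev (2 ℕ.* k) i ≡ ι k - ι i
dev-2* k i = cong (_- ι i) (trans (n/2≡ι[n]*½ (2 ℕ.* k)) (ι[2*n]*½≡ι[n] k))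

dev-suc-suc : ∀ n k → dev (suc (suc n)) (suc k) ≡ dev n k
dev-suc-suc n k = begin
    (⁺ (2 ℕ.+ n)) / 2 - ι (1 ℕ.+ k)  ≡⟨ cong₂ _-_ (trans (n/2≡ι[n]*½ (2 ℕ.+ n)) (cong (_* ½) (ι-+ 2 n))) (ι-+ 1 k) ⟩
    (ι 2 + ι n) * ½ - (ι 1 + ι k)    ≡⟨ solve 2 (λ n k → (con (ι 2) :+ n) :* con ½ :- (con (ι 1) :+ k) := n :* con ½ :- k) refl (ι n) (ι k) ⟩
    ι n * ½ - ι k                    ≡⟨ cong (_- ι k) (sym (n/2≡ι[n]*½ n)) ⟩
    (⁺ n) / 2 - ι k                  ∎
  where open ≡-Reasoning

shiftedBinomial : ℕ → ℕ → ℚ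
shiftedBinomial n zero    = 0ℚ
shiftedBinomial n (suc k) = ι (n C k)

sumFrom-shiftedBinomial : ∀ n (g : ℕ → ℚ) →
  sumFrom 0 (suc (suc (suc n))) (λ k → shiftedBinomial n k * g k) ≡ sumFrom 0 (suc n) (λ k → ι (n C k) * g (suc k))
sumFrom-shiftedBinomial n g = begin
    0ℚ * g 0 + sumFrom 1 (suc (suc n)) (λ k → shiftedBinomial n k * g k)  ≡⟨ cong₂ _+_ (*-zeroˡ (g 0)) (sumFrom-shift 1 0 (suc (suc n)) (λ k → shiftedBinomial n k * g k)) ⟩
    0ℚ + sumFrom 0 (suc (suc n)) h                                         ≡⟨ +-identityˡ _ ⟩
    sumFrom 0 (suc (suc n)) h                                              ≡⟨ sumFrom-snoc 0 (suc n) h ⟩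
    sumFrom 0 (suc n) h + ι (n C suc n) * g (suc (suc n))                  ≡⟨ cong (λ z → sumFrom 0 (suc n) h + ι z * g (suc (suc n))) (k>n⇒nCk≡0 {n} {suc n} ℕP.≤-refl) ⟩
    sumFrom 0 (suc n) h + 0ℚ * g (suc (suc n))                             ≡⟨ cong (sumFrom 0 (suc n) h +_) (*-zeroˡ (g (suc (suc n)))) ⟩
    sumFrom 0 (suc n) h + 0ℚ                                               ≡⟨ +-identityʳ _ ⟩
    sumFrom 0 (suc n) h                                                    ∎
  where
    open ≡-Reasoning
    h : ℕ → ℚ
    h k = ι (n C k) * g (suc k)

-- Absorption applied twice: k (N - k) C(N,k) = N (N - 1) C(N - 2, k - 1) for N = n + 2.
binomial-*-dev² : ∀ n k → k ℕ.≤ suc (suc n) →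
  ι (suc (suc n) C k) * (dev (suc (suc n)) k * dev (suc (suc n)) k)
    ≡ ½ * ½ * (ι (suc (suc n)) * ι (suc (suc n))) * ι (suc (suc n) C k) - ι (suc (suc n)) * ι (suc n) * shiftedBinomial n k
binomial-*-dev² n k k≤N = begin
    c * (dev N k * dev N k)                            ≡⟨ cong (λ z → c * ((z - K) * (z - K))) N/2≡[K+M]*½ ⟩
    c * (((K + M) * ½ - K) * ((K + M) * ½ - K))
      ≡⟨ solve 3 (λ c k m → c :* (((k :+ m) :* con ½ :- k) :* ((k :+ m) :* con ½ :- k)) := con ½ :* con ½ :* ((k :+ m) :* (k :+ m)) :* c :- c :* k :* m) refl c K M ⟩
    ½ * ½ * ((K + M) * (K + M)) * c - c * K * M        ≡⟨ cong₂ (λ z w → ½ * ½ * (z * z) * c - w) (sym N≡K+M) (absorption k k≤N) ⟩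
    ½ * ½ * (ι N * ι N) * c - ι N * ι (suc n) * shiftedBinomial n k ∎
  where
    open ≡-Reasoning
    N = suc (suc n)
    c = ι (N C k)
    K = ι k
    M = ι (N ∸ k)
    N≡K+M : ι N ≡ K + M
    N≡K+M = trans (cong ι (sym (ℕP.m+[n∸m]≡n k≤N))) (ι-+ k (N ∸ k))
    N/2≡[K+M]*½ : (⁺ N) / 2 ≡ (K + M) * ½
    N/2≡[K+M]*½ = trans (n/2≡ι[n]*½ N) (cong (_* ½) N≡K+M)
    absorption : ∀ k → k ℕ.≤ N → ι (N C k) * ι k * ι (N ∸ k) ≡ ι N * ι (suc n) * shiftedBinomial n k
    absorption zero    _ = trans (cong (_* ι N) (*-zeroʳ (ι (N C 0)))) (trans (*-zeroˡ (ι N)) (sym (*-zeroʳ (ι N * ι (suc n)))))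
    absorption (suc j) (ℕ.s≤s j≤1+n) = begin
      ι (N C suc j) * ι (suc j) * ι (N ∸ suc j)      ≡⟨ cong (_* ι (N ∸ suc j)) (sym (ι-* (N C suc j) (suc j))) ⟩
      ι ((N C suc j) ℕ.* suc j) * ι (N ∸ suc j)      ≡⟨ sym (ι-* ((N C suc j) ℕ.* suc j) (N ∸ suc j)) ⟩
      ι ((N C suc j) ℕ.* suc j ℕ.* (suc n ∸ j))      ≡⟨ cong ι ([2+n]C[1+k]*[1+k]*[1+n∸k]≡[2+n]*[1+n]*nCk n j j≤1+n) ⟩
      ι (N ℕ.* suc n ℕ.* (n C j))                    ≡⟨ ι-* (N ℕ.* suc n) (n C j) ⟩
      ι (N ℕ.* suc n) * ι (n C j)                    ≡⟨ cong (_* ι (n C j)) (ι-* N (suc n)) ⟩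
      ι N * ι (suc n) * ι (n C j)                    ∎

evenU-recurrence : ∀ r n → evenU (suc r) (suc (suc n)) ≡
  (½ * ½ * (ι (suc (suc n)) * ι (suc (suc n)))) * evenU r (suc (suc n)) + (- (ι (suc (suc n)) * ι (suc n))) * evenU r n
evenU-recurrence r n = begin
    sumFrom 0 (suc N) (λ k → ι (N C k) * (pow (y k) r * y k))
      ≡⟨ sumFrom-cong 0 (suc N) (λ k _ k<1+N → term≡ k (ℕ.s≤s⁻¹ k<1+N)) ⟩
    sumFrom 0 (suc N) (λ k → a * (ι (N C k) * pow (y k) r) + (- b) * (shiftedBinomial n k * pow (y k) r))
      ≡⟨ sumFrom-+ 0 (suc N) (λ k → a * (ι (N C k) * pow (y k) r)) (λ k → (- b) * (shiftedBinomial n k * pow (y k) r)) ⟩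
    sumFrom 0 (suc N) (λ k → a * (ι (N C k) * pow (y k) r)) + sumFrom 0 (suc N) (λ k → (- b) * (shiftedBinomial n k * pow (y k) r))
      ≡⟨ cong₂ _+_ (sumFrom-*ˡ 0 (suc N) a (λ k → ι (N C k) * pow (y k) r)) (sumFrom-*ˡ 0 (suc N) (- b) (λ k → shiftedBinomial n k * pow (y k) r)) ⟩
    a * evenU r N + (- b) * sumFrom 0 (suc N) (λ k → shiftedBinomial n k * pow (y k) r)
      ≡⟨ cong (λ z → a * evenU r N + (- b) * z) (sumFrom-shiftedBinomial n (λ k → pow (y k) r)) ⟩
    a * evenU r N + (- b) * sumFrom 0 (suc n) (λ k → ι (n C k) * pow (y (suc k)) r)
      ≡⟨ cong (λ z → a * evenU r N + (- b) * z) (sumFrom-cong 0 (suc n) (λ k _ _ → cong (λ z → ι (n C k) * pow (z * z) r) (dev-suc-suc n k))) ⟩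
    a * evenU r N + (- b) * evenU r n ∎
  where
    open ≡-Reasoning
    N = suc (suc n)
    a = ½ * ½ * (ι N * ι N)
    b = ι N * ι (suc n)
    y : ℕ → ℚ
    y k = dev N k * dev N k
    term≡ : ∀ k → k ℕ.≤ N → ι (N C k) * (pow (y k) r * y k) ≡ a * (ι (N C k) * pow (y k) r) + (- b) * (shiftedBinomial n k * pow (y k) r)
    term≡ k k≤N = begin
      ι (N C k) * (pow (y k) r * y k)  ≡⟨ solve 3 (λ c p q → c :* (p :* q) := p :* (c :* q)) refl (ι (N C k)) (pow (y k) r) (y k) ⟩
      pow (y k) r * (ι (N C k) * y k)  ≡⟨ cong (pow (y k) r *_) (binomial-*-dev² n k k≤N) ⟩
      pow (y k) r * (a * ι (N C k) - b * shiftedBinomial n k)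
        ≡⟨ solve 5 (λ p a c b s → p :* (a :* c :- b :* s) := a :* (c :* p) :+ (:- b) :* (s :* p)) refl (pow (y k) r) a (ι (N C k)) b (shiftedBinomial n k) ⟩
      a * (ι (N C k) * pow (y k) r) + (- b) * (shiftedBinomial n k * pow (y k) r) ∎

-- At t = n, the 2r-th central moment of the binomial distribution B(n, ½); the recursion is read off
-- from evenU-recurrence.
binomialMoment : ℕ → ℚ → ℚ
binomialMoment zero    t = 1ℚ
binomialMoment (suc r) t = ½ * ½ * (t * t * binomialMoment r t - t * (t - 1ℚ) * binomialMoment r (t - ι 2))

binomialMoment-zero : ∀ r → binomialMoment (suc r) 0ℚ ≡ 0ℚ
binomialMoment-zero r = solve 2 (λ a b → con ½ :* con ½ :* (con 0ℚ :* con 0ℚ :* a :- con 0ℚ :* (con 0ℚ :- con 1ℚ) :* b) := con 0ℚ)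
                              refl (binomialMoment r 0ℚ) (binomialMoment r (0ℚ - ι 2))

evenU≡2^n*binomialMoment : ∀ r n → evenU r n ≡ pow (ι 2) n * binomialMoment r (ι n)
evenU≡2^n*binomialMoment zero n = begin
    sumFrom 0 (suc n) (λ k → ι (n C k) * 1ℚ)  ≡⟨ sumFrom-cong 0 (suc n) (λ k _ _ → *-identityʳ (ι (n C k))) ⟩
    sumFrom 0 (suc n) (λ k → ι (n C k))       ≡⟨ sumFrom-binomial n ⟩
    pow (ι 2) n                               ≡⟨ sym (*-identityʳ _) ⟩
    pow (ι 2) n * 1ℚ                          ∎
  where open ≡-Reasoning
evenU≡2^n*binomialMoment (suc r) zero = begin
    ι (0 C 0) * (pow (0ℚ * 0ℚ) r * (0ℚ * 0ℚ)) + 0ℚ  ≡⟨ solve 2 (λ a p → a :* (p :* (con 0ℚ :* con 0ℚ)) :+ con 0ℚ := con 0ℚ) refl (ι (0 C 0)) (pow (0ℚ * 0ℚ) r) ⟩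
    0ℚ                                              ≡⟨ sym (binomialMoment-zero r) ⟩
    binomialMoment (suc r) 0ℚ                       ≡⟨ sym (*-identityˡ _) ⟩
    pow (ι 2) 0 * binomialMoment (suc r) (ι 0)      ∎
  where open ≡-Reasoning
evenU≡2^n*binomialMoment (suc r) (suc zero) = begin
    evenU (suc r) 1
      ≡⟨ solve 4 (λ a b p q → a :* (p :* con (½ * ½)) :+ (b :* (q :* con (½ * ½)) :+ con 0ℚ) := (a :* p :+ (b :* q :+ con 0ℚ)) :* con (½ * ½))
               refl (ι (1 C 0)) (ι (1 C 1)) (pow (dev 1 0 * dev 1 0) r) (pow (dev 1 1 * dev 1 1) r) ⟩
    evenU r 1 * (½ * ½)                                  ≡⟨ cong (_* (½ * ½)) (evenU≡2^n*binomialMoment r 1) ⟩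
    pow (ι 2) 1 * binomialMoment r (ι 1) * (½ * ½)
      ≡⟨ solve 3 (λ p a b → p :* a :* (con ½ :* con ½) := p :* (con ½ :* con ½ :* (con 1ℚ :* con 1ℚ :* a :- con 1ℚ :* (con 1ℚ :- con 1ℚ) :* b)))
               refl (pow (ι 2) 1) (binomialMoment r 1ℚ) (binomialMoment r (1ℚ - ι 2)) ⟩
    pow (ι 2) 1 * binomialMoment (suc r) (ι 1)           ∎
  where open ≡-Reasoning
evenU≡2^n*binomialMoment (suc r) (suc (suc n)) = begin
    evenU (suc r) N                                              ≡⟨ evenU-recurrence r n ⟩
    a * evenU r N + (- b) * evenU r n                            ≡⟨ cong₂ (λ x y → a * x + (- b) * y) (evenU≡2^n*binomialMoment r N) (evenU≡2^n*binomialMoment r n) ⟩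
    a * (pow (ι 2) n * ι 2 * ι 2 * M (ι N)) + (- b) * (pow (ι 2) n * M (ι n))
      ≡⟨ solve 5 (λ P n₂ n₁ x y → (con ½ :* con ½ :* (n₂ :* n₂)) :* (P :* con (ι 2) :* con (ι 2) :* x) :+ (:- (n₂ :* n₁)) :* (P :* y)
                                   := P :* con (ι 2) :* con (ι 2) :* (con ½ :* con ½ :* (n₂ :* n₂ :* x :- n₂ :* n₁ :* y)))
               refl (pow (ι 2) n) (ι N) (ι (suc n)) (M (ι N)) (M (ι n)) ⟩
    pow (ι 2) N * (½ * ½ * (ι N * ι N * M (ι N) - ι N * ι (suc n) * M (ι n)))
      ≡⟨ cong₂ (λ z w → pow (ι 2) N * (½ * ½ * (ι N * ι N * M (ι N) - ι N * z * M w))) (sym N-1≡1+n) (sym N-2≡n) ⟩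
    pow (ι 2) N * binomialMoment (suc r) (ι N)                  ∎
  where
    open ≡-Reasoning
    N = suc (suc n)
    M = binomialMoment r
    a = ½ * ½ * (ι N * ι N)
    b = ι N * ι (suc n)
    N-1≡1+n : ι N - 1ℚ ≡ ι (suc n)
    N-1≡1+n = trans (cong (_- 1ℚ) (ι-suc (suc n))) (solve 1 (λ x → (con 1ℚ :+ x) :- con 1ℚ := x) refl (ι (suc n)))
    N-2≡n : ι N - ι 2 ≡ ι n
    N-2≡n = trans (cong (_- ι 2) (ι-+ 2 n)) (solve 1 (λ x → (con (ι 2) :+ x) :- con (ι 2) := x) refl (ι n))

-- Written as ¼ (t² (M t - M (t - 2)) + t M (t - 2)), the recursion raises the degree by at most one.
Poly≤-binomialMoment : ∀ r → Poly≤ r (binomialMoment r)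
Poly≤-binomialMoment zero          = Poly≤-const 0 1ℚ
Poly≤-binomialMoment (suc zero)    = Poly≤-cong 1
  (λ t → solve 1 (λ t → con 1ℚ :* (con (½ * ½) :* t :+ con 0ℚ) := con ½ :* con ½ :* (t :* t :* con 1ℚ :- t :* (t :- con 1ℚ) :* con 1ℚ)) refl t)
  (Poly≤-*-affine 0 (½ * ½) 0ℚ (Poly≤-const 0 1ℚ))
Poly≤-binomialMoment (suc (suc r)) = Poly≤-cong (suc (suc r)) M≡
  (Poly≤-scale (suc (suc r)) (½ * ½) (Poly≤-+ (suc (suc r))
    (Poly≤-*-affine (suc r) 1ℚ 0ℚ (Poly≤-*-affine r 1ℚ 0ℚ (Poly≤-difference r (- ι 2) (Poly≤-binomialMoment (suc r)))))
    (Poly≤-*-affine (suc r) 1ℚ 0ℚ (Poly≤-translate (suc r) (- ι 2) (Poly≤-binomialMoment (suc r))))))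
  where
    M = binomialMoment (suc r)
    M≡ : ∀ t → ½ * ½ * ((M t - M (t - ι 2)) * (1ℚ * t + 0ℚ) * (1ℚ * t + 0ℚ) + M (t - ι 2) * (1ℚ * t + 0ℚ)) ≡ binomialMoment (suc (suc r)) t
    M≡ t = solve 3 (λ t a b → con ½ :* con ½ :* ((a :- b) :* (con 1ℚ :* t :+ con 0ℚ) :* (con 1ℚ :* t :+ con 0ℚ) :+ b :* (con 1ℚ :* t :+ con 0ℚ))
                             := con ½ :* con ½ :* (t :* t :* a :- t :* (t :- con 1ℚ) :* b)) refl t (M t) (M (t - ι 2))

-- Values at even n

sumFrom-symmetric : ∀ k (g h : ℕ → ℚ) → (∀ j → 0 ℕ.< j → j ℕ.≤ k → g (k ∸ j) ≡ h j) → (∀ j → 0 ℕ.< j → j ℕ.≤ k → g (k ℕ.+ j) ≡ h j) →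
                    sumFrom 0 (suc (2 ℕ.* k)) g ≡ g k + ι 2 * sumFrom 1 k h
sumFrom-symmetric k g h g[k∸j]≡h g[k+j]≡h = begin
    sumFrom 0 (suc (2 ℕ.* k)) g                     ≡⟨ cong (λ l → sumFrom 0 l g) 1+2k≡k+[1+k] ⟩
    sumFrom 0 (k ℕ.+ suc k) g                       ≡⟨ sumFrom-split 0 k (suc k) g ⟩
    sumFrom 0 k g + (g k + sumFrom (suc k) k g)     ≡⟨ cong₂ (λ x y → x + (g k + y)) below above ⟩
    H + (g k + H)                                   ≡⟨ solve 2 (λ x y → x :+ (y :+ x) := y :+ con (ι 2) :* x) refl H (g k) ⟩
    g k + ι 2 * H                                   ∎
  where
    open ≡-Reasoning
    H = sumFrom 1 k h
    1+2k≡k+[1+k] : suc (2 ℕ.* k) ≡ k ℕ.+ suc k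
    1+2k≡k+[1+k] = trans (cong (λ z → suc (k ℕ.+ z)) (ℕP.+-identityʳ k)) (sym (ℕP.+-suc k k))
    below : sumFrom 0 k g ≡ H
    below = begin
      sumFrom 0 k g                         ≡⟨ sumFrom-reverse k g ⟩
      sumFrom 0 k (λ i → g (k ∸ suc i))     ≡⟨ sym (sumFrom-shift 1 0 k (λ j → g (k ∸ j))) ⟩
      sumFrom 1 k (λ j → g (k ∸ j))         ≡⟨ sumFrom-cong 1 k (λ j 0<j j<1+k → g[k∸j]≡h j 0<j (ℕ.s≤s⁻¹ j<1+k)) ⟩
      H                                     ∎
    above : sumFrom (suc k) k g ≡ H
    above = begin
      sumFrom (suc k) k g                   ≡⟨ cong (λ a → sumFrom a k g) (ℕP.+-comm 1 k) ⟩
      sumFrom (k ℕ.+ 1) k g                 ≡⟨ sumFrom-shift k 1 k g ⟩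
      sumFrom 1 k (λ j → g (k ℕ.+ j))       ≡⟨ sumFrom-cong 1 k (λ j 0<j j<1+k → g[k+j]≡h j 0<j (ℕ.s≤s⁻¹ j<1+k)) ⟩
      H                                     ∎

innerSum : ℕ → ℕ → ℚ
innerSum r k = sumFrom 1 k (λ j → invFact (k ℕ.+ j) * invFact (k ∸ j) * pow (ι j) (2 ℕ.* r))

evenU-even : ∀ r k → evenU (suc r) (2 ℕ.* k) ≡ ι 2 * (ι ((2 ℕ.* k) !) * innerSum (suc r) k)
evenU-even r k = begin
    evenU (suc r) N                     ≡⟨ sumFrom-symmetric k g h g[k∸j]≡h g[k+j]≡h ⟩
    g k + ι 2 * sumFrom 1 k h           ≡⟨ cong (λ z → ι (N C k) * pow (z * z) (suc r) + ι 2 * sumFrom 1 k h) (trans (dev-2* k k) (+-inverseʳ (ι k))) ⟩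
    ι (N C k) * (pow (0ℚ * 0ℚ) r * (0ℚ * 0ℚ)) + ι 2 * sumFrom 1 k h
      ≡⟨ cong (_+ ι 2 * sumFrom 1 k h) (solve 2 (λ a p → a :* (p :* (con 0ℚ :* con 0ℚ)) := con 0ℚ) refl (ι (N C k)) (pow (0ℚ * 0ℚ) r)) ⟩
    0ℚ + ι 2 * sumFrom 1 k h            ≡⟨ +-identityˡ _ ⟩
    ι 2 * sumFrom 1 k h                 ≡⟨ cong (ι 2 *_) (sumFrom-*ˡ 1 k (ι (N !)) (λ j → invFact (k ℕ.+ j) * invFact (k ∸ j) * pow (ι j) (2 ℕ.* suc r))) ⟩
    ι 2 * (ι (N !) * innerSum (suc r) k) ∎
  where
    open ≡-Reasoning
    N = 2 ℕ.* k
    g : ℕ → ℚ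
    g i = ι (N C i) * pow (dev N i * dev N i) (suc r)
    h : ℕ → ℚ
    h j = ι (N !) * (invFact (k ℕ.+ j) * invFact (k ∸ j) * pow (ι j) (2 ℕ.* suc r))
    ι[NC[k+j]]*j²ʳ≡h : ∀ j → j ℕ.≤ k → ι (N C (k ℕ.+ j)) * pow (ι j * ι j) (suc r) ≡ h j
    ι[NC[k+j]]*j²ʳ≡h j j≤k = trans (cong₂ _*_ (ι[[2k]C[k+j]]≡[2k]!/[[k+j]!*[k∸j]!] k j j≤k) (sym (pow-2* (ι j) (suc r))))
                                   (*-assoc (ι (N !)) _ _)
    g[k+j]≡h : ∀ j → 0 ℕ.< j → j ℕ.≤ k → g (k ℕ.+ j) ≡ h j
    g[k+j]≡h j _ j≤k = trans (cong (λ z → ι (N C (k ℕ.+ j)) * pow (z * z) (suc r)) dev≡-j)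
                             (trans (cong (λ z → ι (N C (k ℕ.+ j)) * pow z (suc r)) (solve 1 (λ b → (:- b) :* (:- b) := b :* b) refl (ι j)))
                                    (ι[NC[k+j]]*j²ʳ≡h j j≤k))
      where
        dev≡-j : dev N (k ℕ.+ j) ≡ - ι j
        dev≡-j = trans (dev-2* k (k ℕ.+ j)) (trans (cong (λ z → ι k - z) (ι-+ k j)) (solve 2 (λ a b → a :- (a :+ b) := :- b) refl (ι k) (ι j)))
    g[k∸j]≡h : ∀ j → 0 ℕ.< j → j ℕ.≤ k → g (k ∸ j) ≡ h j
    g[k∸j]≡h j _ j≤k = trans (cong₂ (λ x z → ι x * pow (z * z) (suc r)) ([2k]C[k∸j]≡[2k]C[k+j] k j j≤k) dev≡j) (ι[NC[k+j]]*j²ʳ≡h j j≤k)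
      where
        dev≡j : dev N (k ∸ j) ≡ ι j
        dev≡j = trans (dev-2* k (k ∸ j)) (trans (cong (λ z → ι k - z) (ι-∸ k j j≤k)) (solve 2 (λ a b → a :- (a :- b) := b) refl (ι k) (ι j)))

rising½k*k!*4^k≡[2k]! : ∀ k → rising ½ k * ι (k !) * pow (ι 4) k ≡ ι ((2 ℕ.* k) !)
rising½k*k!*4^k≡[2k]! zero    = refl
rising½k*k!*4^k≡[2k]! (suc k) = begin
    rising ½ k * (½ + ι k) * ι (suc k ℕ.* k !) * (pow (ι 4) k * ι 4)
      ≡⟨ cong (λ z → rising ½ k * (½ + ι k) * z * (pow (ι 4) k * ι 4)) (trans (ι-* (suc k) (k !)) (cong (_* ι (k !)) (ι-suc k))) ⟩
    rising ½ k * (½ + ι k) * ((1ℚ + ι k) * ι (k !)) * (pow (ι 4) k * ι 4)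
      ≡⟨ solve 4 (λ R K f P → R :* (con ½ :+ K) :* ((con 1ℚ :+ K) :* f) :* (P :* con (ι 4)) := (R :* f :* P) :* ((con 1ℚ :+ (con 1ℚ :+ con (ι 2) :* K)) :* (con 1ℚ :+ con (ι 2) :* K)))
               refl (rising ½ k) (ι k) (ι (k !)) (pow (ι 4) k) ⟩
    (rising ½ k * ι (k !) * pow (ι 4) k) * ((1ℚ + (1ℚ + ι 2 * ι k)) * (1ℚ + ι 2 * ι k))
      ≡⟨ cong₂ (λ x y → x * ((1ℚ + (1ℚ + y)) * (1ℚ + y))) (rising½k*k!*4^k≡[2k]! k) (sym (ι-* 2 k)) ⟩
    ι (N !) * ((1ℚ + (1ℚ + ι N)) * (1ℚ + ι N))
      ≡⟨ cong₂ (λ x y → ι (N !) * (x * y)) (sym (trans (ι-suc (suc N)) (cong (1ℚ +_) (ι-suc N)))) (sym (ι-suc N)) ⟩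
    ι (N !) * (ι (suc (suc N)) * ι (suc N))
      ≡⟨ solve 3 (λ x a b → x :* (a :* b) := a :* (b :* x)) refl (ι (N !)) (ι (suc (suc N))) (ι (suc N)) ⟩
    ι (suc (suc N)) * (ι (suc N) * ι (N !))   ≡⟨ cong (ι (suc (suc N)) *_) (sym (ι-* (suc N) (N !))) ⟩
    ι (suc (suc N)) * ι (suc N ℕ.* N !)       ≡⟨ sym (ι-* (suc (suc N)) (suc N ℕ.* N !)) ⟩
    ι (suc (suc N) !)                         ≡⟨ cong (λ z → ι (z !)) (sym (ℕP.*-suc 2 k)) ⟩
    ι ((2 ℕ.* suc k) !)                       ∎
  where
    open ≡-Reasoning
    N = 2 ℕ.* k

binomialMoment-even : ∀ r k → rising ½ k * innerSum (suc r) k ≡ ½ * (invFact k * binomialMoment (suc r) (ι (2 ℕ.* k)))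
binomialMoment-even r k = begin
    B * S                                     ≡⟨ sym (trans (cong₂ (λ x y → B * S * (x * y)) (invFact-inverseˡ k) ¼ᵏ*4ᵏ≡1) (*-identityʳ (B * S))) ⟩
    B * S * ((k!⁻¹ * ι (k !)) * (¼ᵏ * 4ᵏ))
      ≡⟨ solve 6 (λ B S f a q p → B :* S :* ((f :* a) :* (q :* p)) := f :* q :* con ½ :* (con (ι 2) :* ((B :* a :* p) :* S))) refl B S k!⁻¹ (ι (k !)) ¼ᵏ 4ᵏ ⟩
    k!⁻¹ * ¼ᵏ * ½ * (ι 2 * ((B * ι (k !) * 4ᵏ) * S))  ≡⟨ cong (λ z → k!⁻¹ * ¼ᵏ * ½ * (ι 2 * (z * S))) (rising½k*k!*4^k≡[2k]! k) ⟩
    k!⁻¹ * ¼ᵏ * ½ * (ι 2 * (ι ((2 ℕ.* k) !) * S))     ≡⟨ cong (k!⁻¹ * ¼ᵏ * ½ *_) (trans (sym (evenU-even r k)) (evenU≡2^n*binomialMoment (suc r) (2 ℕ.* k))) ⟩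
    k!⁻¹ * ¼ᵏ * ½ * (pow (ι 2) (2 ℕ.* k) * M)        ≡⟨ cong (λ z → k!⁻¹ * ¼ᵏ * ½ * (z * M)) (pow-2* (ι 2) k) ⟩
    k!⁻¹ * ¼ᵏ * ½ * (4ᵏ * M)                         ≡⟨ solve 5 (λ f q p M h → f :* q :* h :* (p :* M) := (q :* p) :* (h :* (f :* M))) refl k!⁻¹ ¼ᵏ 4ᵏ M ½ ⟩
    (¼ᵏ * 4ᵏ) * (½ * (k!⁻¹ * M))                     ≡⟨ cong (_* (½ * (k!⁻¹ * M))) ¼ᵏ*4ᵏ≡1 ⟩
    1ℚ * (½ * (k!⁻¹ * M))                           ≡⟨ *-identityˡ _ ⟩
    ½ * (k!⁻¹ * M)                                  ∎
  where
    open ≡-Reasoning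
    B = rising ½ k
    S = innerSum (suc r) k
    k!⁻¹ = invFact k
    ¼ᵏ = pow (½ * ½) k
    4ᵏ = pow (ι 4) k
    M = binomialMoment (suc r) (ι (2 ℕ.* k))
    ¼ᵏ*4ᵏ≡1 : ¼ᵏ * 4ᵏ ≡ 1ℚ
    ¼ᵏ*4ᵏ≡1 = pow-inverse (½ * ½) (ι 4) k refl

binomialMoment-interpolation : ∀ r n → binomialMoment r (ι n) ≡
  pow (- 1ℚ) r * sumFrom 0 (suc r) (λ k → lagrangeBasis r k ((⁺ n) / 2) * binomialMoment r (ι (2 ℕ.* k)))
binomialMoment-interpolation r n = begin
    binomialMoment r (ι n)                   ≡⟨ cong (binomialMoment r) (sym 2*n/2≡n) ⟩
    binomialMoment r (ι 2 * ((⁺ n) / 2))    ≡⟨ lagrange-interpolation r (Poly≤-dilate r (ι 2) (Poly≤-binomialMoment r)) ((⁺ n) / 2) ⟩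
    pow (- 1ℚ) r * sumFrom 0 (suc r) (λ k → lagrangeBasis r k ((⁺ n) / 2) * binomialMoment r (ι 2 * ι k))
      ≡⟨ cong (pow (- 1ℚ) r *_) (sumFrom-cong 0 (suc r) (λ k _ _ → cong (λ z → lagrangeBasis r k ((⁺ n) / 2) * binomialMoment r z) (sym (ι-* 2 k)))) ⟩
    pow (- 1ℚ) r * sumFrom 0 (suc r) (λ k → lagrangeBasis r k ((⁺ n) / 2) * binomialMoment r (ι (2 ℕ.* k))) ∎
  where
    open ≡-Reasoning
    2*n/2≡n : ι 2 * ((⁺ n) / 2) ≡ ι n
    2*n/2≡n = trans (cong (ι 2 *_) (n/2≡ι[n]*½ n)) (solve 1 (λ x → con (ι 2) :* (x :* con ½) := x) refl (ι n))

RHS-innerSum : ∀ r n k → let h = (⁺ n) / 2 in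
  sumFrom 1 k (λ j → rising (- h) k * rising ½ k * rising (h - ι (suc r)) (suc r ∸ k)
                     * (invFact (k ℕ.+ j) * invFact (k ∸ j) * invFact (suc r ∸ k)) * pow (ι j) (2 ℕ.* suc r))
    ≡ ½ * (lagrangeBasis (suc r) k h * binomialMoment (suc r) (ι (2 ℕ.* k)))
RHS-innerSum r n k = begin
    sumFrom 1 k (λ j → P₁ * P₂ * P₃ * (invFact (k ℕ.+ j) * invFact (k ∸ j) * c) * pow (ι j) (2 ℕ.* suc r))
      ≡⟨ sumFrom-cong 1 k (λ j _ _ → solve 7 (λ P₁ P₂ P₃ c a b p → P₁ :* P₂ :* P₃ :* (a :* b :* c) :* p := (P₁ :* P₃ :* c :* P₂) :* (a :* b :* p))
                                            refl P₁ P₂ P₃ c (invFact (k ℕ.+ j)) (invFact (k ∸ j)) (pow (ι j) (2 ℕ.* suc r))) ⟩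
    sumFrom 1 k (λ j → (P₁ * P₃ * c * P₂) * (invFact (k ℕ.+ j) * invFact (k ∸ j) * pow (ι j) (2 ℕ.* suc r)))
      ≡⟨ sumFrom-*ˡ 1 k (P₁ * P₃ * c * P₂) (λ j → invFact (k ℕ.+ j) * invFact (k ∸ j) * pow (ι j) (2 ℕ.* suc r)) ⟩
    P₁ * P₃ * c * P₂ * innerSum (suc r) k         ≡⟨ *-assoc (P₁ * P₃ * c) P₂ (innerSum (suc r) k) ⟩
    P₁ * P₃ * c * (P₂ * innerSum (suc r) k)       ≡⟨ cong (P₁ * P₃ * c *_) (binomialMoment-even r k) ⟩
    P₁ * P₃ * c * (½ * (invFact k * M))
      ≡⟨ solve 6 (λ P₁ P₃ c h f M → P₁ :* P₃ :* c :* (h :* (f :* M)) := h :* (P₁ :* P₃ :* (f :* c) :* M)) refl P₁ P₃ c ½ (invFact k) M ⟩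
    ½ * (P₁ * P₃ * (invFact k * c) * M)          ∎
  where
    open ≡-Reasoning
    h = (⁺ n) / 2
    P₁ = rising (- h) k
    P₂ = rising ½ k
    P₃ = rising (h - ι (suc r)) (suc r ∸ k)
    c = invFact (suc r ∸ k)
    M = binomialMoment (suc r) (ι (2 ℕ.* k))

mainTheorem9 : (r n : ℕ) → r ℕ.≥ 1 → n ℕ.≥ 1 → U (2 ℕ.* r) n ≡ RHS r n
mainTheorem9 r@(suc r′) n _ _ = begin
    U (2 ℕ.* r) n                                         ≡⟨ U-even r n ⟩
    evenU r n                                             ≡⟨ evenU≡2^n*binomialMoment r n ⟩
    pow (ι 2) n * binomialMoment r (ι n)                  ≡⟨ cong (pow (ι 2) n *_) (binomialMoment-interpolation r n) ⟩
    pow (ι 2) n * (±1 * (T 0 + sumFrom 1 r T))            ≡⟨ cong (λ z → pow (ι 2) n * (±1 * (z + sumFrom 1 r T))) T0≡0 ⟩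
    pow (ι 2) n * (±1 * (0ℚ + sumFrom 1 r T))
      ≡⟨ solve 3 (λ P s S → P :* (s :* (con 0ℚ :+ S)) := s :* (P :* con (ι 2)) :* (con ½ :* S)) refl (pow (ι 2) n) ±1 (sumFrom 1 r T) ⟩
    ±1 * (pow (ι 2) n * ι 2) * (½ * sumFrom 1 r T)        ≡⟨ cong (±1 * (pow (ι 2) n * ι 2) *_) (sym (sumFrom-*ˡ 1 r ½ T)) ⟩
    ±1 * (pow (ι 2) n * ι 2) * sumFrom 1 r (λ k → ½ * T k) ≡⟨ cong (±1 * (pow (ι 2) n * ι 2) *_) (sym (sumFrom-cong 1 r (λ k _ _ → RHS-innerSum r′ n k))) ⟩
    RHS r n                                               ∎
  where
    open ≡-Reasoning
    ±1 = pow (- 1ℚ) r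
    T : ℕ → ℚ
    T k = lagrangeBasis r k ((⁺ n) / 2) * binomialMoment r (ι (2 ℕ.* k))
    T0≡0 : T 0 ≡ 0ℚ
    T0≡0 = trans (cong (lagrangeBasis r 0 ((⁺ n) / 2) *_) (binomialMoment-zero r′)) (*-zeroʳ (lagrangeBasis r 0 ((⁺ n) / 2)))
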